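{- Let $n \ge 1$, let $T$ be a Cayley tree of size $n$ and let $w$ be a node of $T$. Let $f = \varphi(T,w)$ be the $n$-mapping defined as follows. Let $v_1 = w, v_2 = T(v_1), \dots, v_{i+1} = T(v_i), \dots, v_r = \mathrm{root}(T)$ be the path from $w$ to the root. Let $I = (i_1,\dots,i_t)$ with $i_1 < \dots < i_t$ be the indices of the right-to-left maxima of the sequence $v_1,\dots,v_r$ (i.e. $i \in I$ iff $v_i > v_j$ for all $j > i$), and let $V_I = \{v_i : i \in I\}$. Define $f(v) = T(v)$ if $v \notin V_I$; $f(v_{i_1}) = v_1$; and $f(v_{i_\ell}) = T(v_{i_{\ell-1}})$ for $1 < \ell \le t$. Then for every node $v \in [n]$: (1) $T(v) > v$ if and only if $f(v) > v$; (2) there exists a node $x < v$ with $T(x) = v$ if and only if there exists an element $x < v$ with $f(x) = v$.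
   Context: A Cayley tree of size $n$ is an unordered rooted tree on $n$ nodes labelled by distinct elements of $[n]=\{1,\dots,n\}$, with edges oriented towards the root. For a node $v$ of a tree $T$, $T(v)$ denotes the parent of $v$ (so $(v,T(v))$ is an edge) if $v$ is not the root, and by convention $T(\mathrm{root}(T)) = \mathrm{root}(T)$. An $n$-mapping is a function $f:[n]\to[n]$. (The map $\varphi$ described is a bijection from pairs $(T,w)$ to $n$-mappings.) -}

module Defs where

open import Data.Nat using (ℕ; zero; suc)
open import Data.Fin using (Fin; _<_; _<?_; _≟_)
open import Data.List using (List; []; _∷_; zip; map)
open import Data.List.Relation.Unary.All using (All; all?)
open import Data.Product using (Σ; ∃; _×_; _,_)
open import Relation.Nullary using (yes; no)
open import Relation.Binary.PropositionalEquality using (_≡_)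

iter : {A : Set} → (A → A) → ℕ → A → A
iter f zero    x = x
iter f (suc k) x = f (iter f k x)

-- A Cayley tree of size n on node set Fin n (label i+1 ↔ Fin element i,
-- order-preserving), given by its parent map T, with T root = root, and
-- every node reaching the root by iterating T (so the graph is a tree
-- oriented towards the root; the root is the unique fixed point).
IsCayleyTree : (n : ℕ) → (Fin n → Fin n) → Set
IsCayleyTree n T =
  Σ (Fin n) λ r → (T r ≡ r) × (∀ v → ∃ λ k → iter T k v ≡ r)

-- path v, T v, T (T v), ..., root  (the root is the fixed point of T);
-- fuel n suffices since a path in a tree on n nodes has ≤ n nodes.
pathWith : {n : ℕ} → (Fin n → Fin n) → ℕ → Fin n → List (Fin n)
pathWith T zero    v = v ∷ []
pathWith T (suc k) v with T v ≟ v
... | yes _ = v ∷ []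
... | no  _ = v ∷ pathWith T k (T v)

rootPath : {n : ℕ} → (Fin n → Fin n) → Fin n → List (Fin n)
rootPath {n} T w = pathWith T n w

rlMaxima : {n : ℕ} → List (Fin n) → List (Fin n)
rlMaxima []       = []
rlMaxima (x ∷ xs) with all? (λ y → y <? x) xs
... | yes _ = x ∷ rlMaxima xs
... | no  _ = rlMaxima xs

assoc : {n : ℕ} → List (Fin n × Fin n) → Fin n → Fin n → Fin n
assoc []             d v = d
assoc ((a , b) ∷ ps) d v with a ≟ v
... | yes _ = b
... | no  _ = assoc ps d v

-- φ(T,w): with v_{i_1},...,v_{i_t} the right-to-left maxima of the path
-- from w to the root:  v_{i_1} ↦ w,  v_{i_ℓ} ↦ T(v_{i_{ℓ-1}}) (1<ℓ≤t),
-- and every other v ↦ T v.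
φ : {n : ℕ} → (Fin n → Fin n) → Fin n → (Fin n → Fin n)
φ T w v = assoc (zip ms (w ∷ map T ms)) (T v) v
  where ms = rlMaxima (rootPath T w)

module Submission where

-- The whole theorem rests on one local invariant of f = φ(T,w): at every
-- node v, either f v = T v, or v is a weak descent of both maps
-- (T v ≤ v and f v ≤ v).  Call such a value f v *admissible* at v.
-- Admissibility forces "v < T v ⇔ v < f v", and whenever v < T v or v < f v
-- it forces f v = T v; parts (1) and (2) are immediate from this.
--
-- For the maxima this holds because each maximum dominates everything
--     after it, in particular its own T-image and the new image.
--   * The main theorem, by taking s = w.

open import Defs
open import Data.Nat using (ℕ; zero; suc; _+_; _*_; _∸_; z≤n; s≤s)
import Data.Nat as ℕ
import Data.Nat.Properties as ℕₚ
open import Data.Fin using (Fin; _<_; _≤_; _<?_; _≟_; toℕ)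
open import Data.Fin.Properties using (pigeonhole; toℕ<n)
open import Data.List using (List; []; _∷_; zip; map)
open import Data.List.Relation.Unary.All using (All; all?; []; _∷_; lookupWith)
open import Data.List.Relation.Unary.All.Properties using (¬All⇒Any¬)
open import Data.List.Relation.Unary.Any using (Any; here; there)
import Data.List.Relation.Unary.Any as Any
open import Data.Product using (∃; _×_; _,_)
open import Data.Sum using (_⊎_; inj₁; inj₂)
open import Data.Empty using (⊥-elim)
open import Function.Bundles using (_⇔_; mk⇔)
open import Relation.Nullary using (yes; no; ¬_)
open import Relation.Binary.PropositionalEquality using (_≡_; refl; sym; trans; cong; subst; module ≡-Reasoning)

module Iteration {A : Set} (f : A → A) where

  iter-suc : ∀ k x → iter f (suc k) x ≡ iter f k (f x)
  iter-suc zero    x = refl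
  iter-suc (suc k) x = cong f (iter-suc k x)

  iter-+ : ∀ a b x → iter f (a + b) x ≡ iter f a (iter f b x)
  iter-+ zero    b x = refl
  iter-+ (suc a) b x = cong f (iter-+ a b x)

  iter-comm : ∀ a b x → iter f a (iter f b x) ≡ iter f b (iter f a x)
  iter-comm a b x = trans (sym (iter-+ a b x))
                          (trans (cong (λ c → iter f c x) (ℕₚ.+-comm a b)) (iter-+ b a x))

  iter-fixed : ∀ {r} → f r ≡ r → ∀ t → iter f t r ≡ r
  iter-fixed fr zero    = refl
  iter-fixed fr (suc t) = trans (cong f (iter-fixed fr t)) fr

  iter-periodic : ∀ {p y} → iter f p y ≡ y → ∀ m → iter f (m * p) y ≡ y
  iter-periodic         py zero    = refl
  iter-periodic {p} {y} py (suc m) =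
    trans (iter-+ p (m * p) y) (trans (cong (iter f p) (iter-periodic py m)) py)

  -- A periodic point y that reaches a fixed point r is r itself: after a
  -- multiple of the period that is at least k we are back at y, but also at r.
  periodic-reaches-fixed : ∀ {p y r} k → 1 ℕ.≤ p → iter f p y ≡ y →
                           f r ≡ r → iter f k y ≡ r → y ≡ r
  periodic-reaches-fixed {p} {y} {r} k 1≤p py fr ky = begin
      y                               ≡⟨ sym (iter-periodic py k) ⟩
      iter f (k * p) y                ≡⟨ cong (λ c → iter f c y) (sym (ℕₚ.m∸n+n≡m k≤kp)) ⟩
      iter f ((k * p ∸ k) + k) y      ≡⟨ iter-+ (k * p ∸ k) k y ⟩
      iter f (k * p ∸ k) (iter f k y) ≡⟨ cong (iter f (k * p ∸ k)) ky ⟩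
      iter f (k * p ∸ k) r            ≡⟨ iter-fixed fr (k * p ∸ k) ⟩
      r                               ∎
    where
      open ≡-Reasoning
      k≤kp : k ℕ.≤ k * p
      k≤kp = ℕₚ.≤-trans (ℕₚ.≤-reflexive (sym (ℕₚ.*-identityʳ k))) (ℕₚ.*-monoʳ-≤ k 1≤p)

-- On Fin n, a fixed point reachable from w is reached within n steps:
-- among w, f w, …, fⁿ w two coincide, so fᵃ w is periodic for some a ≤ n,
-- and it reaches r, hence equals r.
reach-within : ∀ {n} (f : Fin n → Fin n) {r w} k → f r ≡ r → iter f k w ≡ r →
               ∃ λ i → i ℕ.≤ n × iter f i w ≡ r
reach-within {n} f {r} {w} k fr kw
  with a , b , a<b , eq ← pigeonhole (ℕₚ.n<1+n n) (λ i → iter f (toℕ i) w)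
  = toℕ a , ℕₚ.≤-trans (ℕₚ.<⇒≤ a<b) (ℕₚ.≤-pred (toℕ<n b))
  , periodic-reaches-fixed k (ℕₚ.m<n⇒0<n∸m a<b) periodic fr reaches
  where
    open Iteration f
    p = toℕ b ∸ toℕ a
    periodic : iter f p (iter f (toℕ a) w) ≡ iter f (toℕ a) w
    periodic = trans (sym (iter-+ p (toℕ a) w))
                     (trans (cong (λ c → iter f c w) (ℕₚ.m∸n+n≡m (ℕₚ.<⇒≤ a<b))) (sym eq))
    reaches : iter f k (iter f (toℕ a) w) ≡ r
    reaches = trans (iter-comm k (toℕ a) w) (trans (cong (iter f (toℕ a)) kw) (iter-fixed fr (toℕ a)))

module _ {n : ℕ} (T : Fin n → Fin n) where

  -- Walk x xs: xs is T x, T² x, … up to and including the first fixed point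
  -- of T (empty if x is itself fixed).
  data Walk : Fin n → List (Fin n) → Set where
    stop : ∀ {x} → T x ≡ x → Walk x []
    step : ∀ {x ys} → Walk (T x) ys → Walk x (T x ∷ ys)

  pathWith-walk : ∀ {r} → T r ≡ r → ∀ k i v → i ℕ.≤ k → iter T i v ≡ r →
                  ∃ λ ys → pathWith T k v ≡ v ∷ ys × Walk v ys
  pathWith-walk Tr zero    .zero v z≤n refl = [] , refl , stop Tr
  pathWith-walk Tr (suc k) i v i≤k iv with T v ≟ v
  ... | yes Tv≡v = [] , refl , stop Tv≡v
  pathWith-walk Tr (suc k) zero    v _         refl | no Tv≢v = ⊥-elim (Tv≢v Tr)
  pathWith-walk Tr (suc k) (suc i) v (s≤s i≤k) iv   | no _
    with ys , eq , walk ← pathWith-walk Tr k i (T v) i≤k (trans (sym (Iteration.iter-suc T i v)) iv)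
    rewrite eq = T v ∷ ys , refl , step walk

  rootPath-walk : IsCayleyTree n T → ∀ w → ∃ λ ys → rootPath T w ≡ w ∷ ys × Walk w ys
  rootPath-walk (r , Tr , reachAll) w
    with k , kw ← reachAll w
    with i , i≤n , iw ← reach-within T k Tr kw
    = pathWith-walk Tr n i w i≤n iw

  Admissible : Fin n → Fin n → Set
  Admissible a v = a ≡ T v ⊎ (T v ≤ v × a ≤ v)

  ascentᵀ-agrees : ∀ {a v} → Admissible a v → v < T v → a ≡ T v
  ascentᵀ-agrees (inj₁ a≡Tv)      _  = a≡Tv
  ascentᵀ-agrees (inj₂ (Tv≤v , _)) lt = ⊥-elim (ℕₚ.<-irrefl refl (ℕₚ.<-≤-trans lt Tv≤v))

  ascentᵃ-agrees : ∀ {a v} → Admissible a v → v < a → a ≡ T v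
  ascentᵃ-agrees (inj₁ a≡Tv)      _  = a≡Tv
  ascentᵃ-agrees (inj₂ (_ , a≤v)) lt = ⊥-elim (ℕₚ.<-irrefl refl (ℕₚ.<-≤-trans lt a≤v))

  -- φ with the maxima list ms and the seed s (the image of the first maximum)
  -- left as parameters; φ T w is relink (rlMaxima (rootPath T w)) w.
  relink : List (Fin n) → Fin n → Fin n → Fin n
  relink ms s v = assoc (zip ms (s ∷ map T ms)) (T v) v

  maximum-descends : ∀ {x xs} → Walk x xs → All (λ (y : Fin n) → y < x) xs → T x ≤ x
  maximum-descends (stop Tx≡x) _         = ℕₚ.≤-reflexive (cong toℕ Tx≡x)
  maximum-descends (step _)    (Tx<x ∷ _) = ℕₚ.<⇒≤ Tx<x

  bounded-by-maximum : ∀ {s x : Fin n} {xs} → All (λ (y : Fin n) → y < x) xs → Any (λ (y : Fin n) → s ≤ y) xs → s ≤ x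
  bounded-by-maximum = lookupWith (λ y<x s≤y → ℕₚ.≤-trans s≤y (ℕₚ.<⇒≤ y<x))

  -- A head that is not a right-to-left maximum is dominated by a later
  -- element, so a bound witnessed by the head survives dropping it.
  drop-non-maximum : ∀ {s x : Fin n} {xs} → ¬ All (λ (y : Fin n) → y < x) xs → Any (λ (y : Fin n) → s ≤ y) (x ∷ xs) → Any (λ (y : Fin n) → s ≤ y) xs
  drop-non-maximum {s} {x} {xs} notMax (here s≤x) =
    Any.map (λ x≮y → ℕₚ.≤-trans s≤x (ℕₚ.≮⇒≥ x≮y)) (¬All⇒Any¬ (_<? x) xs notMax)
  drop-non-maximum notMax (there bound) = bound

  -- Past a maximum x the remaining maxima are relinked with seed T x, the
  -- head of the rest of the walk; past a non-maximum the seed is unchanged.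
  relink-admissible : ∀ {x xs} → Walk x xs → ∀ s → Any (λ (y : Fin n) → s ≤ y) (x ∷ xs) → ∀ v →
                      Admissible (relink (rlMaxima (x ∷ xs)) s v) v
  relink-admissible {x} {xs} walk s bound v with all? (_<? x) xs
  ... | yes isMax with x ≟ v
  ...   | yes refl = inj₂ (maximum-descends walk isMax , seed≤x bound)
    where
      seed≤x : Any (λ (y : Fin n) → s ≤ y) (x ∷ xs) → s ≤ x
      seed≤x (here s≤x)  = s≤x
      seed≤x (there s≤y) = bounded-by-maximum isMax s≤y
  relink-admissible (stop _)    s bound v | yes _ | no _ = inj₁ refl
  relink-admissible (step walk) s bound v | yes _ | no _ =
    relink-admissible walk _ (here ℕₚ.≤-refl) v
  relink-admissible (stop _)    s bound v | no notMax = ⊥-elim (notMax [])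
  relink-admissible (step walk) s bound v | no notMax =
    relink-admissible walk s (drop-non-maximum notMax bound) v

  φ-admissible : IsCayleyTree n T → ∀ w v → Admissible (φ T w v) v
  φ-admissible tree w v
    with ys , path≡ , walk ← rootPath-walk tree w
    = subst (λ p → Admissible (relink (rlMaxima p) w v) v) (sym path≡)
            (relink-admissible walk w (here ℕₚ.≤-refl) v)

mainTheorem1 : (n : ℕ) (T : Fin n → Fin n) → IsCayleyTree n T → (w : Fin n) →
    ∀ v →
    ((v < T v) ⇔ (v < φ T w v))
    × ((∃ λ x → x < v × T x ≡ v) ⇔ (∃ λ x → x < v × φ T w x ≡ v))
mainTheorem1 n T tree w v =
  mk⇔ (λ v<Tv → subst (v <_) (sym (ascentᵀ-agrees T (adm v) v<Tv)) v<Tv)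
      (λ v<fv → subst (v <_) (ascentᵃ-agrees T (adm v) v<fv) v<fv)
  , mk⇔ (λ { (x , x<v , Tx≡v) → x , x<v , trans (ascentᵀ-agrees T (adm x) (ascent x<v Tx≡v)) Tx≡v })
        (λ { (x , x<v , fx≡v) → x , x<v , trans (sym (ascentᵃ-agrees T (adm x) (ascent x<v fx≡v))) fx≡v })
  where
    adm : ∀ u → Admissible T (φ T w u) u
    adm = φ-admissible T tree w
    ascent : ∀ {x y z : Fin n} → x < y → z ≡ y → x < z
    ascent x<y z≡y = subst (_ <_) (sym z≡y) x<y
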